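{- Let $M=M[U,L]$ be a lattice path matroid of rank $r$ on $r+m$ elements, and let $\mathrm{st}(L)=(L_1,\dots,L_{r+m})$ and $\mathrm{st}(U)=(U_1,\dots,U_{r+m})$. Then the set $\mathcal{C}_M$ of step vectors of all generalized lattice paths of $M$ equals $$\left\{p\in\mathbb{R}^{r+m}\;\middle|\; 0\leq p_i\leq 1 \text{ and } \sum_{j=1}^i L_j\leq \sum_{j=1}^i p_j\leq \sum_{j=1}^i U_j \text{ for all } i\in\{1,\dots,r+m\} \right\}.$$
   Context: A lattice path from $(0,0)$ to $(m,r)$ is a path using unit steps $(1,0)$ and $(0,1)$; its step vector is $\mathrm{st}(P)=(P_1,\dots,P_{r+m})\in\{0,1\}^{r+m}$, where $P_i$ is the $y$-coordinate change of the $i$-th step. For lattice paths $U,L$ from $(0,0)$ to $(m,r)$ with $L$ never going above $U$, the lattice path matroid $M[U,L]$ is the matroid on $\{1,\dots,r+m\}$ whose bases are the sets $\{i: P_i=1\}$ for all lattice paths $P$ from $(0,0)$ to $(m,r)$ that never go above $U$ and never go below $L$; it has rank $r$. Let $R(M)$ be the closed region of the plane bounded by $U$ and $L$, let $l_i$ be the line $x+y=i$, and let $T_i=l_i\cap R(M)$ for $i=0,\dots,r+m$. A generalized lattice path $P$ of $M$ is a polygonal path with vertices (bend points) $(x_0,y_0),\dots,(x_{r+m},y_{r+m})$, where $(x_i,y_i)\in T_i$ for each $i$, and $x_i\le x_{i+1}$, $y_i\le y_{i+1}$ for $i=0,\dots,r+m-1$; its step vector is $\mathrm{st}(P)=(P_1,\dots,P_{r+m})$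 with $P_{i+1}=y_{i+1}-y_i$. -}

module Defs where

open import Data.Nat using (ℕ; zero; suc) renaming (_+_ to _+ℕ_; _≤_ to _≤ℕ_)
open import Data.Bool using (Bool; true; false)
open import Data.Fin using (Fin; zero; suc; toℕ; inject₁)
open import Data.Product using (Σ; ∃; _×_; _,_)
open import Data.Sum using (_⊎_)
open import Relation.Binary.PropositionalEquality using (_≡_; _≢_)
open import Function using (_∘_)

-- The real numbers, axiomatised as a (Dedekind-)complete ordered field.
-- Any model of this record is (isomorphic to) ℝ; the theorem is stated
-- for an arbitrary such model.

record RealField : Set₁ where
  infixl 6 _+_
  infixl 7 _*_
  infix  4 _≤_
  field
    ℝ    : Set
    _+_  : ℝ → ℝ → ℝ
    _*_  : ℝ → ℝ → ℝ
    -_   : ℝ → ℝ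
    0ℝ   : ℝ
    1ℝ   : ℝ
    _≤_  : ℝ → ℝ → Set
    +-assoc    : ∀ x y z → (x + y) + z ≡ x + (y + z)
    +-comm     : ∀ x y → x + y ≡ y + x
    +-identity : ∀ x → 0ℝ + x ≡ x
    +-inverse  : ∀ x → x + (- x) ≡ 0ℝ
    *-assoc    : ∀ x y z → (x * y) * z ≡ x * (y * z)
    *-comm     : ∀ x y → x * y ≡ y * x
    *-identity : ∀ x → 1ℝ * x ≡ x
    distrib    : ∀ x y z → x * (y + z) ≡ x * y + x * z
    *-inverse  : ∀ x → x ≢ 0ℝ → Σ ℝ (λ y → x * y ≡ 1ℝ)
    0≢1        : 0ℝ ≢ 1ℝ
    ≤-refl     : ∀ x → x ≤ x
    ≤-trans    : ∀ {x y z} → x ≤ y → y ≤ z → x ≤ z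
    ≤-antisym  : ∀ {x y} → x ≤ y → y ≤ x → x ≡ y
    ≤-total    : ∀ x y → x ≤ y ⊎ y ≤ x
    +-mono-≤   : ∀ {x y} z → x ≤ y → x + z ≤ y + z
    *-nonneg   : ∀ {x y} → 0ℝ ≤ x → 0ℝ ≤ y → 0ℝ ≤ x * y
    sup        : (S : ℝ → Set) → Σ ℝ S → Σ ℝ (λ b → ∀ x → S x → x ≤ b) →
                 Σ ℝ (λ s → (∀ x → S x → x ≤ s) ×
                            (∀ b → (∀ x → S x → x ≤ b) → s ≤ b))

  _-_ : ℝ → ℝ → ℝ
  x - y = x + (- y)

  fromℕ : ℕ → ℝ
  fromℕ zero    = 0ℝ
  fromℕ (suc n) = 1ℝ + fromℕ n

-- Lattice paths, given by their step vectors (true = north step (0,1),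
-- false = east step (1,0)).

ncount : ∀ {n} → (Fin n → Bool) → Fin (suc n) → ℕ
ncount         P zero    = 0
ncount {suc n} P (suc i) with P zero
... | true  = suc (ncount (P ∘ suc) i)
... | false = ncount (P ∘ suc) i

-- a lattice path from (0,0) to (m,r): r+m steps, exactly r of them north
IsLatticePath : (r m : ℕ) → (Fin (r +ℕ m) → Bool) → Set
IsLatticePath r m P = ncount P (Data.Fin.fromℕ (r +ℕ m)) ≡ r

NeverAbove : ∀ {n} → (Fin n → Bool) → (Fin n → Bool) → Set
NeverAbove {n} L U = ∀ (i : Fin (suc n)) → ncount L i ≤ℕ ncount U i

module _ (R : RealField) where
  open RealField R

  bool→ℝ : Bool → ℝ
  bool→ℝ true  = 1ℝ
  bool→ℝ false = 0ℝ

  psum : ∀ {n} → (Fin n → ℝ) → Fin (suc n) → ℝ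
  psum         p zero    = 0ℝ
  psum {suc n} p (suc i) = p zero + psum (p ∘ suc) i

  -- k-th vertex of the lattice path with step vector P
  vy : ∀ {n} → (Fin n → Bool) → Fin (suc n) → ℝ
  vy P k = psum (bool→ℝ ∘ P) k

  vx : ∀ {n} → (Fin n → Bool) → Fin (suc n) → ℝ
  vx P k = fromℕ (toℕ k) - vy P k

  OnPath : ∀ {n} → (Fin n → Bool) → ℝ → ℝ → Set
  OnPath {n} P x y =
    (x ≡ 0ℝ × y ≡ 0ℝ) ⊎
    Σ (Fin n) λ k → Σ ℝ λ t → 0ℝ ≤ t × t ≤ 1ℝ ×
      x ≡ vx P (inject₁ k) + t * (1ℝ - bool→ℝ (P k)) ×
      y ≡ vy P (inject₁ k) + t * bool→ℝ (P k)

  InRegion : ∀ {n} → (U L : Fin n → Bool) → ℝ → ℝ → Set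
  InRegion U L x y =
    Σ ℝ (λ y₁ → OnPath L x y₁ × y₁ ≤ y) ×
    Σ ℝ (λ y₂ → OnPath U x y₂ × y ≤ y₂)

  record GenLatticePath {n} (U L : Fin n → Bool) : Set where
    field
      xs : Fin (suc n) → ℝ
      ys : Fin (suc n) → ℝ
      onLine   : ∀ i → xs i + ys i ≡ fromℕ (toℕ i)
      inRegion : ∀ i → InRegion U L (xs i) (ys i)
      x-mono   : ∀ (i : Fin n) → xs (inject₁ i) ≤ xs (suc i)
      y-mono   : ∀ (i : Fin n) → ys (inject₁ i) ≤ ys (suc i)

    st : Fin n → ℝ
    st i = ys (suc i) - ys (inject₁ i)

  InPolytope : ∀ {n} → (U L : Fin n → Bool) → (Fin n → ℝ) → Set
  InPolytope {n} U L p =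
    (∀ (i : Fin n) → 0ℝ ≤ p i × p i ≤ 1ℝ) ×
    (∀ (i : Fin n) → psum (bool→ℝ ∘ L) (suc i) ≤ psum p (suc i) ×
                     psum p (suc i) ≤ psum (bool→ℝ ∘ U) (suc i))

  InCM : ∀ {n} → (U L : Fin n → Bool) → (Fin n → ℝ) → Set
  InCM U L p = Σ (GenLatticePath U L) λ P → ∀ i → GenLatticePath.st P i ≡ p i

module Submission where

-- The proof rests on one geometric description of the slices T_i of the
-- region R(M): a point (x,y) on the line x + y = i lies in R(M) exactly
-- when vy L i ≤ y ≤ vy U i, where vy P i is the height of the i-th vertex
-- of the lattice path P.
--   * "⇒" (region-heights) uses that every point of a monotone staircase
--     path is coordinatewise comparable with each of its vertices.
--   * "⇐" (heights-in-region) uses an intermediate value property: a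
--     lattice path meets every vertical line between two of its vertices,
--     at a height between the heights of these vertices.
-- With this description the theorem is bookkeeping with partial sums: the
-- heights y_i of a generalized lattice path are the partial sums of its
-- step vector (telescoping), and conversely the partial sums of a point of
-- the polytope are the heights of a generalized lattice path.

open import Defs
open import Data.Nat using (ℕ; zero; suc; z≤n) renaming (_+_ to _+ℕ_; _≤_ to _≤ℕ_)
import Data.Nat.Properties as ℕ
open import Data.Bool using (Bool; true; false)
open import Data.Fin as Fin using (Fin; zero; suc; toℕ; inject₁)
open import Data.Fin.Properties using (toℕ-inject₁; ≤fromℕ)
open import Data.Fin.Induction using (<-weakInduction-startingFrom)
open import Data.Product using (Σ; _×_; _,_; proj₁; proj₂)
open import Data.Sum using (_⊎_; inj₁; inj₂)
open import Function using (_∘_)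
open import Relation.Nullary using (yes; no)
open import Relation.Binary.PropositionalEquality
  using (_≡_; refl; sym; trans; cong; cong₂; subst; isEquivalence)
open import Relation.Binary.Bundles using (Poset)
open import Algebra.Bundles using (CommutativeRing)
import Algebra.Properties.Ring as RingProperties
import Algebra.Properties.CommutativeSemigroup as CommutativeSemigroupProperties
import Relation.Binary.Reasoning.PartialOrder as PartialOrderReasoning

module GeneralizedLatticePaths (R : RealField) where
  open RealField R

  commutativeRing : CommutativeRing _ _
  commutativeRing = record
    { Carrier = ℝ ; _≈_ = _≡_ ; _+_ = _+_ ; _*_ = _*_ ; -_ = -_
    ; 0# = 0ℝ ; 1# = 1ℝ
    ; isCommutativeRing = record
      { isRing = record
        { +-isAbelianGroup = record
          { isGroup = record
            { isMonoid = record
              { isSemigroup = record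
                { isMagma = record { isEquivalence = isEquivalence ; ∙-cong = cong₂ _+_ }
                ; assoc = +-assoc }
              ; identity = +-identity , λ x → trans (+-comm x 0ℝ) (+-identity x) }
            ; inverse = (λ x → trans (+-comm (- x) x) (+-inverse x)) , +-inverse
            ; ⁻¹-cong = cong (λ x → - x) }
          ; comm = +-comm }
        ; *-cong = cong₂ _*_
        ; *-assoc = *-assoc
        ; *-identity = *-identity , λ x → trans (*-comm x 1ℝ) (*-identity x)
        ; distrib = distrib , λ x y z →
            trans (*-comm (y + z) x) (trans (distrib x y z) (cong₂ _+_ (*-comm x y) (*-comm x z))) }
      ; *-comm = *-comm } }

  open CommutativeRing commutativeRing using (+-identityʳ; *-identityʳ; zeroʳ)
  open RingProperties (CommutativeRing.ring commutativeRing)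
    using ( -0#≈0#; -‿+-comm; -‿involutive; -‿distribˡ-*
          ; //-rightDividesˡ; //-rightDividesʳ; \\-leftDividesʳ)
  open CommutativeSemigroupProperties (CommutativeRing.+-commutativeSemigroup commutativeRing)
    using (interchange)

  ≤-poset : Poset _ _ _
  ≤-poset = record
    { _≈_ = _≡_ ; _≤_ = _≤_
    ; isPartialOrder = record
      { isPreorder = record
        { isEquivalence = isEquivalence ; reflexive = λ { {x} refl → ≤-refl x } ; trans = ≤-trans }
      ; antisym = ≤-antisym } }

  open PartialOrderReasoning ≤-poset

  sub-add : ∀ y x → (y - x) + x ≡ y
  sub-add y x = //-rightDividesˡ x y

  add-sub : ∀ y x → (y + x) - x ≡ y
  add-sub y x = //-rightDividesʳ x y

  sub-distrib : ∀ a b c d → (a + b) - (c + d) ≡ (a - c) + (b - d)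
  sub-distrib a b c d = begin-equality
    (a + b) + - (c + d)     ≡⟨ cong ((a + b) +_) (sym (-‿+-comm c d)) ⟩
    (a + b) + (- c + - d)   ≡⟨ interchange a b (- c) (- d) ⟩
    (a - c) + (b - d)       ∎

  telescope-step : ∀ a b c → (a - b) + (c - a) ≡ c - b
  telescope-step a b c = begin-equality
    (a - b) + (c - a)   ≡⟨ +-comm (a - b) (c - a) ⟩
    (c - a) + (a - b)   ≡⟨ +-assoc c (- a) (a - b) ⟩
    c + (- a + (a - b)) ≡⟨ cong (c +_) (\\-leftDividesʳ a (- b)) ⟩
    c - b               ∎

  ≤-reflexive : ∀ {x y} → x ≡ y → x ≤ y
  ≤-reflexive {x} refl = ≤-refl x

  +-monoʳ-≤ : ∀ z {x y} → x ≤ y → z + x ≤ z + y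
  +-monoʳ-≤ z {x} {y} x≤y = begin
    z + x ≡⟨ +-comm z x ⟩
    x + z ≤⟨ +-mono-≤ z x≤y ⟩
    y + z ≡⟨ +-comm y z ⟩
    z + y ∎

  +-cancelˡ-≤ : ∀ z {x y} → z + x ≤ z + y → x ≤ y
  +-cancelˡ-≤ z {x} {y} le = begin
    x              ≡⟨ sym (\\-leftDividesʳ z x) ⟩
    - z + (z + x)  ≤⟨ +-monoʳ-≤ (- z) le ⟩
    - z + (z + y)  ≡⟨ \\-leftDividesʳ z y ⟩
    y              ∎

  ≤-+-nonneg : ∀ a {c} → 0ℝ ≤ c → a ≤ a + c
  ≤-+-nonneg a {c} 0≤c = begin
    a      ≡⟨ sym (+-identityʳ a) ⟩
    a + 0ℝ ≤⟨ +-monoʳ-≤ a 0≤c ⟩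
    a + c  ∎

  x≤y⇒0≤y-x : ∀ {x y} → x ≤ y → 0ℝ ≤ y - x
  x≤y⇒0≤y-x {x} {y} x≤y = begin
    0ℝ    ≡⟨ sym (+-inverse x) ⟩
    x - x ≤⟨ +-mono-≤ (- x) x≤y ⟩
    y - x ∎

  0≤y-x⇒x≤y : ∀ {x y} → 0ℝ ≤ y - x → x ≤ y
  0≤y-x⇒x≤y {x} {y} 0≤y-x = +-cancelˡ-≤ (- x) (begin
    - x + x        ≡⟨ trans (+-comm (- x) x) (+-inverse x) ⟩
    0ℝ             ≤⟨ 0≤y-x ⟩
    y - x          ≡⟨ +-comm y (- x) ⟩
    - x + y        ∎)

  ≤-by-nonneg-summand : ∀ {a b c} → 0ℝ ≤ a → a + b ≡ c → b ≤ c
  ≤-by-nonneg-summand {a} {b} {c} 0≤a a+b≡c = begin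
    b      ≡⟨ sym (+-identity b) ⟩
    0ℝ + b ≤⟨ +-mono-≤ b 0≤a ⟩
    a + b  ≡⟨ a+b≡c ⟩
    c      ∎

  line-antitone : ∀ {x y x′ y′} → x + y ≡ x′ + y′ → x ≤ x′ → y′ ≤ y
  line-antitone {x} {y} {x′} {y′} same x≤x′ = +-cancelˡ-≤ x (begin
    x + y′   ≤⟨ +-mono-≤ y′ x≤x′ ⟩
    x′ + y′  ≡⟨ sym same ⟩
    x + y    ∎)

  -- in an ordered field 1 is positive: otherwise 0 ≤ -1 and so 0 ≤ (-1)(-1) = 1
  0≤1 : 0ℝ ≤ 1ℝ
  0≤1 with ≤-total 0ℝ 1ℝ
  ... | inj₁ 0≤1 = 0≤1
  ... | inj₂ 1≤0 = begin
    0ℝ                ≤⟨ *-nonneg 0≤-1 0≤-1 ⟩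
    (- 1ℝ) * (- 1ℝ)   ≡⟨ sym (-‿distribˡ-* 1ℝ (- 1ℝ)) ⟩
    - (1ℝ * (- 1ℝ))   ≡⟨ cong (λ z → - z) (*-identity (- 1ℝ)) ⟩
    - (- 1ℝ)          ≡⟨ -‿involutive 1ℝ ⟩
    1ℝ                ∎
    where
    0≤-1 : 0ℝ ≤ - 1ℝ
    0≤-1 = begin
      0ℝ        ≡⟨ sym (+-inverse 1ℝ) ⟩
      1ℝ - 1ℝ   ≤⟨ +-mono-≤ (- 1ℝ) 1≤0 ⟩
      0ℝ - 1ℝ   ≡⟨ +-identity (- 1ℝ) ⟩
      - 1ℝ      ∎

  scale-≤ : ∀ {t c} → t ≤ 1ℝ → 0ℝ ≤ c → t * c ≤ c
  scale-≤ {t} {c} t≤1 0≤c = 0≤y-x⇒x≤y (begin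
    0ℝ                   ≤⟨ *-nonneg (x≤y⇒0≤y-x t≤1) 0≤c ⟩
    (1ℝ - t) * c         ≡⟨ *-comm (1ℝ - t) c ⟩
    c * (1ℝ - t)         ≡⟨ distrib c 1ℝ (- t) ⟩
    c * 1ℝ + c * (- t)   ≡⟨ cong₂ _+_ (*-identityʳ c) (*-comm c (- t)) ⟩
    c + (- t) * c        ≡⟨ cong (c +_) (sym (-‿distribˡ-* t c)) ⟩
    c - (t * c)          ∎)

  xOn : ∀ {n} → Fin (suc n) → ℝ → ℝ
  xOn i y = fromℕ (toℕ i) - y

  xOn-on-line : ∀ {n} (i : Fin (suc n)) y → xOn i y + y ≡ fromℕ (toℕ i)
  xOn-on-line i y = sub-add (fromℕ (toℕ i)) y

  xOn-antitone : ∀ {n} (i : Fin (suc n)) {y y′} → y ≤ y′ → xOn i y′ ≤ xOn i y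
  xOn-antitone i {y} {y′} y≤y′ = line-antitone same-line y≤y′
    where
    same-line : y + xOn i y ≡ y′ + xOn i y′
    same-line = trans (+-comm y _) (trans (xOn-on-line i y) (sym (trans (+-comm y′ _) (xOn-on-line i y′))))

  xOn-suc : ∀ {n} (k : Fin n) y q → xOn (suc k) (y + q) ≡ xOn (inject₁ k) y + (1ℝ - q)
  xOn-suc k y q = begin-equality
    (1ℝ + fromℕ (toℕ k)) - (y + q)          ≡⟨ cong (_- (y + q)) (+-comm 1ℝ (fromℕ (toℕ k))) ⟩
    (fromℕ (toℕ k) + 1ℝ) - (y + q)          ≡⟨ sub-distrib (fromℕ (toℕ k)) 1ℝ y q ⟩
    (fromℕ (toℕ k) - y) + (1ℝ - q)          ≡⟨ cong (λ j → (fromℕ j - y) + (1ℝ - q)) (sym (toℕ-inject₁ k)) ⟩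
    (fromℕ (toℕ (inject₁ k)) - y) + (1ℝ - q) ∎

  psum-snoc : ∀ {n} (p : Fin n → ℝ) (k : Fin n) → psum R p (suc k) ≡ psum R p (inject₁ k) + p k
  psum-snoc p zero    = trans (+-identityʳ (p zero)) (sym (+-identity (p zero)))
  psum-snoc p (suc k) = trans (cong (p zero +_) (psum-snoc (p ∘ suc) k)) (sym (+-assoc _ _ _))

  psum-cong : ∀ {n} {p q : Fin n → ℝ} → (∀ i → p i ≡ q i) → ∀ j → psum R p j ≡ psum R q j
  psum-cong p≡q zero          = refl
  psum-cong {suc n} p≡q (suc j) = cong₂ _+_ (p≡q zero) (psum-cong (p≡q ∘ suc) j)

  telescope : ∀ {n} (f : Fin (suc n) → ℝ) j →
              psum R (λ i → f (suc i) - f (inject₁ i)) j ≡ f j - f zero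
  telescope f zero          = sym (+-inverse (f zero))
  telescope {suc n} f (suc j) = begin-equality
    (f (suc zero) - f zero) + psum R (λ i → f (suc (suc i)) - f (suc (inject₁ i))) j
      ≡⟨ cong ((f (suc zero) - f zero) +_) (telescope (f ∘ suc) j) ⟩
    (f (suc zero) - f zero) + (f (suc j) - f (suc zero))
      ≡⟨ telescope-step (f (suc zero)) (f zero) (f (suc j)) ⟩
    f (suc j) - f zero ∎

  stepwise-monotone : ∀ {n} (f : Fin (suc n) → ℝ) → (∀ k → f (inject₁ k) ≤ f (suc k)) →
                      ∀ {i j} → i Fin.≤ j → f i ≤ f j
  stepwise-monotone f step {i} =
    <-weakInduction-startingFrom (λ j → f i ≤ f j) (≤-refl (f i)) (λ k fi≤fk → ≤-trans fi≤fk (step k))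

  rise : Bool → ℝ
  rise = bool→ℝ R

  run : Bool → ℝ
  run b = 1ℝ - rise b

  0≤rise : ∀ b → 0ℝ ≤ rise b
  0≤rise true  = 0≤1
  0≤rise false = ≤-refl 0ℝ

  run-north : run true ≡ 0ℝ
  run-north = +-inverse 1ℝ

  run-east : run false ≡ 1ℝ
  run-east = trans (cong (1ℝ +_) -0#≈0#) (+-identityʳ 1ℝ)

  0≤run : ∀ b → 0ℝ ≤ run b
  0≤run true  = ≤-reflexive (sym run-north)
  0≤run false = ≤-trans 0≤1 (≤-reflexive (sym run-east))

  module Vertices {n} (P : Fin n → Bool) where

    vx-zero : vx R P zero ≡ 0ℝ
    vx-zero = +-inverse 0ℝ

    vy-snoc : ∀ k → vy R P (suc k) ≡ vy R P (inject₁ k) + rise (P k)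
    vy-snoc = psum-snoc (rise ∘ P)

    vx-snoc : ∀ k → vx R P (suc k) ≡ vx R P (inject₁ k) + run (P k)
    vx-snoc k = trans (cong (xOn (suc k)) (vy-snoc k)) (xOn-suc k (vy R P (inject₁ k)) (rise (P k)))

    vy-step : ∀ k → vy R P (inject₁ k) ≤ vy R P (suc k)
    vy-step k = ≤-trans (≤-+-nonneg _ (0≤rise (P k))) (≤-reflexive (sym (vy-snoc k)))

    vx-step : ∀ k → vx R P (inject₁ k) ≤ vx R P (suc k)
    vx-step k = ≤-trans (≤-+-nonneg _ (0≤run (P k))) (≤-reflexive (sym (vx-snoc k)))

    vy-mono : ∀ {i j} → i Fin.≤ j → vy R P i ≤ vy R P j
    vy-mono = stepwise-monotone (vy R P) vy-step

    vx-mono : ∀ {i j} → i Fin.≤ j → vx R P i ≤ vx R P j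
    vx-mono = stepwise-monotone (vx R P) vx-step

    0≤vx : ∀ i → 0ℝ ≤ vx R P i
    0≤vx i = ≤-trans (≤-reflexive (sym vx-zero)) (vx-mono {zero} {i} z≤n)

    -- every vertex lies on the path (the i-th one at the end of segment i-1)
    vertex-on-path : ∀ i → OnPath R P (vx R P i) (vy R P i)
    vertex-on-path zero    = inj₁ (vx-zero , refl)
    vertex-on-path (suc k) = inj₂ (k , 1ℝ , 0≤1 , ≤-refl 1ℝ ,
      trans (vx-snoc k) (cong (vx R P (inject₁ k) +_) (sym (*-identity (run (P k))))) ,
      trans (vy-snoc k) (cong (vy R P (inject₁ k) +_) (sym (*-identity (rise (P k))))))

    comparable : ∀ {x y} → OnPath R P x y → ∀ i →
                 (x ≤ vx R P i × y ≤ vy R P i) ⊎ (vx R P i ≤ x × vy R P i ≤ y)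
    comparable (inj₁ (refl , refl)) i =
      inj₁ (0≤vx i , vy-mono {zero} {i} z≤n)
    comparable (inj₂ (k , t , 0≤t , t≤1 , refl , refl)) i with toℕ i ℕ.≤? toℕ k
    ... | yes i≤k = inj₂
      ( ≤-trans (vx-mono (i≤inject₁ i≤k)) (≤-+-nonneg _ (*-nonneg 0≤t (0≤run (P k))))
      , ≤-trans (vy-mono (i≤inject₁ i≤k)) (≤-+-nonneg _ (*-nonneg 0≤t (0≤rise (P k)))) )
      where
      i≤inject₁ : toℕ i ≤ℕ toℕ k → i Fin.≤ inject₁ k
      i≤inject₁ i≤k = ℕ.≤-trans i≤k (ℕ.≤-reflexive (sym (toℕ-inject₁ k)))
    ... | no i≰k = inj₁
      ( ≤-trans (+-monoʳ-≤ _ (scale-≤ t≤1 (0≤run (P k))))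
                (≤-trans (≤-reflexive (sym (vx-snoc k))) (vx-mono (ℕ.≰⇒> i≰k)))
      , ≤-trans (+-monoʳ-≤ _ (scale-≤ t≤1 (0≤rise (P k))))
                (≤-trans (≤-reflexive (sym (vy-snoc k))) (vy-mono (ℕ.≰⇒> i≰k))) )

    -- Intermediate value property of one segment: the segment k meets every
    -- vertical line between its endpoints, and it does so at the height of
    -- its upper endpoint (an east step is flat, a north step is vertical).
    segment-meets : ∀ k {x} → vx R P (inject₁ k) ≤ x → x ≤ vx R P (suc k) →
                    OnPath R P x (vy R P (suc k))
    segment-meets k {x} lo hi with P k in Pk≡
    ... | false = inj₂ (k , t , x≤y⇒0≤y-x lo , t≤1 , sym x≡ , y≡)
      where
      east : run (P k) ≡ 1ℝ
      east = trans (cong run Pk≡) run-east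

      flat : rise (P k) ≡ 0ℝ
      flat = cong rise Pk≡

      t = x - vx R P (inject₁ k)

      t≤1 : t ≤ 1ℝ
      t≤1 = begin
        x - vx R P (inject₁ k)                                ≤⟨ +-mono-≤ _ hi ⟩
        vx R P (suc k) - vx R P (inject₁ k)                   ≡⟨ cong (_- vx R P (inject₁ k)) (trans (vx-snoc k) (+-comm _ _)) ⟩
        (run (P k) + vx R P (inject₁ k)) - vx R P (inject₁ k) ≡⟨ add-sub (run (P k)) _ ⟩
        run (P k)                                             ≡⟨ east ⟩
        1ℝ                                                    ∎

      x≡ : vx R P (inject₁ k) + t * run (P k) ≡ x
      x≡ = begin-equality
        vx R P (inject₁ k) + t * run (P k) ≡⟨ cong (λ z → vx R P (inject₁ k) + t * z) east ⟩
        vx R P (inject₁ k) + t * 1ℝ        ≡⟨ cong (vx R P (inject₁ k) +_) (*-identityʳ t) ⟩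
        vx R P (inject₁ k) + t             ≡⟨ +-comm _ t ⟩
        t + vx R P (inject₁ k)             ≡⟨ sub-add x _ ⟩
        x                                  ∎

      y≡ : vy R P (suc k) ≡ vy R P (inject₁ k) + t * rise (P k)
      y≡ = begin-equality
        vy R P (suc k)                      ≡⟨ vy-snoc k ⟩
        vy R P (inject₁ k) + rise (P k)     ≡⟨ cong (vy R P (inject₁ k) +_) (trans flat (sym (zeroʳ t))) ⟩
        vy R P (inject₁ k) + t * 0ℝ         ≡⟨ cong (λ z → vy R P (inject₁ k) + t * z) (sym flat) ⟩
        vy R P (inject₁ k) + t * rise (P k) ∎
    ... | true = subst (λ z → OnPath R P z (vy R P (suc k))) x≡ (vertex-on-path (suc k))
      where
      -- a north step is vertical, so x is the common x-coordinate of its ends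
      x≡ : vx R P (suc k) ≡ x
      x≡ = ≤-antisym (begin
        vx R P (suc k)                 ≡⟨ vx-snoc k ⟩
        vx R P (inject₁ k) + run (P k) ≡⟨ cong (vx R P (inject₁ k) +_) (trans (cong run Pk≡) run-north) ⟩
        vx R P (inject₁ k) + 0ℝ        ≡⟨ +-identityʳ _ ⟩
        vx R P (inject₁ k)             ≤⟨ lo ⟩
        x                              ∎) hi

    meets-vertical : ∀ {a b x} → a Fin.≤ b → vx R P a ≤ x → x ≤ vx R P b →
                     Σ ℝ λ y → OnPath R P x y × vy R P a ≤ y × y ≤ vy R P b
    meets-vertical {a} {b} {x} a≤b = induction a≤b a≤b
      where
      -- the claim for the vertex j; it assumes a ≤ j, which the inductive
      -- step needs to decide whether the line is reached before vertex j
      Meets : Fin (suc n) → Set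
      Meets j = a Fin.≤ j → vx R P a ≤ x → x ≤ vx R P j →
                Σ ℝ λ y → OnPath R P x y × vy R P a ≤ y × y ≤ vy R P j

      at-vertex : Meets a
      at-vertex _ lo hi with ≤-antisym hi lo
      ... | refl = vy R P a , vertex-on-path a , ≤-refl _ , ≤-refl _

      -- the segment k meets the line; a ≤ suc k keeps the height above vy a
      on-segment : ∀ k → a Fin.≤ suc k → vx R P (inject₁ k) ≤ x → x ≤ vx R P (suc k) →
                   Σ ℝ λ y → OnPath R P x y × vy R P a ≤ y × y ≤ vy R P (suc k)
      on-segment k a≤sk lo hi = vy R P (suc k) , segment-meets k lo hi , vy-mono a≤sk , ≤-refl _

      -- either the line is met before vertex k, or on the segment k
      next : ∀ k → Meets (inject₁ k) → Meets (suc k)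
      next k meets a≤sk lo hi with toℕ a ℕ.≤? toℕ (inject₁ k)
      ... | no a≰k = on-segment k a≤sk (≤-trans (vx-mono (ℕ.<⇒≤ (ℕ.≰⇒> a≰k))) lo) hi
      ... | yes a≤k with ≤-total x (vx R P (inject₁ k))
      ...   | inj₂ right = on-segment k a≤sk right hi
      ...   | inj₁ left with meets a≤k lo left
      ...     | y , on , ay , yk = y , on , ay , ≤-trans yk (vy-step k)

      induction : ∀ {j} → a Fin.≤ j → Meets j
      induction = <-weakInduction-startingFrom Meets at-vertex next

  vy-ncount : ∀ {n} (P : Fin n → Bool) i → vy R P i ≡ fromℕ (ncount P i)
  vy-ncount P zero = refl
  vy-ncount {suc n} P (suc i) with P zero
  ... | true  = cong (1ℝ +_) (vy-ncount (P ∘ suc) i)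
  ... | false = trans (+-identity _) (vy-ncount (P ∘ suc) i)

  same-endpoint : ∀ {r m} {U L : Fin (r +ℕ m) → Bool} → IsLatticePath r m U → IsLatticePath r m L →
                  vy R L (Fin.fromℕ (r +ℕ m)) ≡ vy R U (Fin.fromℕ (r +ℕ m))
  same-endpoint {r} {m} {U} {L} U-path L-path = begin-equality
    vy R L (Fin.fromℕ (r +ℕ m))        ≡⟨ vy-ncount L (Fin.fromℕ (r +ℕ m)) ⟩
    fromℕ (ncount L (Fin.fromℕ (r +ℕ m))) ≡⟨ cong fromℕ (trans L-path (sym U-path)) ⟩
    fromℕ (ncount U (Fin.fromℕ (r +ℕ m))) ≡⟨ sym (vy-ncount U (Fin.fromℕ (r +ℕ m))) ⟩
    vy R U (Fin.fromℕ (r +ℕ m))        ∎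

  line-gap : ∀ {n} (k : Fin n) → fromℕ (toℕ (suc k)) - fromℕ (toℕ (inject₁ {n} k)) ≡ 1ℝ
  line-gap k = trans (cong (λ j → (1ℝ + fromℕ (toℕ k)) - fromℕ j) (toℕ-inject₁ k)) (add-sub 1ℝ (fromℕ (toℕ k)))

  module Slices {n} (U L : Fin n → Bool) where
    private
      module U = Vertices U
      module L = Vertices L

    last : Fin (suc n)
    last = Fin.fromℕ n

    region-heights : ∀ i {x y} → x + y ≡ fromℕ (toℕ i) → InRegion R U L x y →
                     vy R L i ≤ y × y ≤ vy R U i
    region-heights i {x} {y} on-line ((y₁ , on-L , y₁≤y) , (y₂ , on-U , y≤y₂)) = above-L , below-U
      where
      above-L : vy R L i ≤ y
      above-L with L.comparable on-L i
      ... | inj₁ (x≤vx , _) = line-antitone (trans on-line (sym (xOn-on-line i (vy R L i)))) x≤vx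
      ... | inj₂ (_ , vy≤y₁) = ≤-trans vy≤y₁ y₁≤y

      below-U : y ≤ vy R U i
      below-U with U.comparable on-U i
      ... | inj₁ (_ , y₂≤vy) = ≤-trans y≤y₂ y₂≤vy
      ... | inj₂ (vx≤x , _) = line-antitone (trans (xOn-on-line i (vy R U i)) (sym on-line)) vx≤x

    heights-in-region : vy R L last ≡ vy R U last → ∀ i {y} → vy R L i ≤ y → y ≤ vy R U i →
                        InRegion R U L (xOn i y) y
    heights-in-region same-end i {y} L≤y y≤U = below-point-of-L , above-point-of-U
      where
      0≤x : 0ℝ ≤ xOn i y
      0≤x = ≤-trans (U.0≤vx i) (xOn-antitone i y≤U)

      x≤vx-last : xOn i y ≤ vx R U last
      x≤vx-last = ≤-trans (xOn-antitone i L≤y)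
                          (≤-trans (L.vx-mono (≤fromℕ i)) (≤-reflexive (cong (xOn last) same-end)))

      below-point-of-L : Σ ℝ λ y₁ → OnPath R L (xOn i y) y₁ × y₁ ≤ y
      below-point-of-L
        with L.meets-vertical {zero} {i} z≤n (≤-trans (≤-reflexive L.vx-zero) 0≤x) (xOn-antitone i L≤y)
      ... | y₁ , on-L , _ , y₁≤L = y₁ , on-L , ≤-trans y₁≤L L≤y

      above-point-of-U : Σ ℝ λ y₂ → OnPath R U (xOn i y) y₂ × y ≤ y₂
      above-point-of-U
        with U.meets-vertical {i} {last} (≤fromℕ i) (xOn-antitone i y≤U) x≤vx-last
      ... | y₂ , on-U , U≤y₂ , _ = y₂ , on-U , ≤-trans y≤U U≤y₂

    necessity : ∀ p → InCM R U L p → InPolytope R U L p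
    necessity p (G , st≡p) = steps-in-unit , sums-between
      where
      open GenLatticePath G

      -- the path starts at the origin, the only point of the slice T_0
      y₀≡0 : ys zero ≡ 0ℝ
      y₀≡0 = let (lo , hi) = region-heights zero (onLine zero) (inRegion zero) in ≤-antisym hi lo

      heights : ∀ j → psum R p j ≡ ys j
      heights j = begin-equality
        psum R p j         ≡⟨ sym (psum-cong st≡p j) ⟩
        psum R st j        ≡⟨ telescope ys j ⟩
        ys j - ys zero     ≡⟨ cong (λ z → ys j - z) y₀≡0 ⟩
        ys j - 0ℝ          ≡⟨ trans (cong (ys j +_) -0#≈0#) (+-identityʳ (ys j)) ⟩
        ys j               ∎

      increments : ∀ k → (xs (suc k) - xs (inject₁ k)) + st k ≡ 1ℝ
      increments k = begin-equality
        (xs (suc k) - xs (inject₁ k)) + (ys (suc k) - ys (inject₁ k))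
          ≡⟨ sym (sub-distrib (xs (suc k)) (ys (suc k)) (xs (inject₁ k)) (ys (inject₁ k))) ⟩
        (xs (suc k) + ys (suc k)) - (xs (inject₁ k) + ys (inject₁ k))
          ≡⟨ cong₂ _-_ (onLine (suc k)) (onLine (inject₁ k)) ⟩
        fromℕ (toℕ (suc k)) - fromℕ (toℕ (inject₁ k))
          ≡⟨ line-gap k ⟩
        1ℝ ∎

      steps-in-unit : ∀ k → 0ℝ ≤ p k × p k ≤ 1ℝ
      steps-in-unit k rewrite sym (st≡p k) =
        x≤y⇒0≤y-x (y-mono k) , ≤-by-nonneg-summand (x≤y⇒0≤y-x (x-mono k)) (increments k)

      sums-between : ∀ k → psum R (rise ∘ L) (suc k) ≤ psum R p (suc k) ×
                           psum R p (suc k) ≤ psum R (rise ∘ U) (suc k)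
      sums-between k rewrite heights (suc k) = region-heights (suc k) (onLine (suc k)) (inRegion (suc k))

    sufficiency : vy R L last ≡ vy R U last → ∀ p → InPolytope R U L p → InCM R U L p
    sufficiency same-end p (steps-in-unit , sums-between) = G , st≡p
      where
      heights : Fin (suc n) → ℝ
      heights = psum R p

      bounds : ∀ i → vy R L i ≤ heights i × heights i ≤ vy R U i
      bounds zero    = ≤-refl 0ℝ , ≤-refl 0ℝ
      bounds (suc k) = sums-between k

      x-mono : ∀ k → xOn (inject₁ k) (heights (inject₁ k)) ≤ xOn (suc k) (heights (suc k))
      x-mono k = begin
        xOn (inject₁ k) (heights (inject₁ k))
          ≤⟨ ≤-+-nonneg _ (x≤y⇒0≤y-x (proj₂ (steps-in-unit k))) ⟩
        xOn (inject₁ k) (heights (inject₁ k)) + (1ℝ - p k)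
          ≡⟨ sym (xOn-suc k (heights (inject₁ k)) (p k)) ⟩
        xOn (suc k) (heights (inject₁ k) + p k)
          ≡⟨ cong (xOn (suc k)) (sym (psum-snoc p k)) ⟩
        xOn (suc k) (heights (suc k)) ∎

      G : GenLatticePath R U L
      G = record
        { xs       = λ i → xOn i (heights i)
        ; ys       = heights
        ; onLine   = λ i → xOn-on-line i (heights i)
        ; inRegion = λ i → heights-in-region same-end i (proj₁ (bounds i)) (proj₂ (bounds i))
        ; x-mono   = x-mono
        ; y-mono   = λ k → ≤-trans (≤-+-nonneg _ (proj₁ (steps-in-unit k))) (≤-reflexive (sym (psum-snoc p k)))
        }

      st≡p : ∀ k → GenLatticePath.st G k ≡ p k
      st≡p k = begin-equality
        heights (suc k) - heights (inject₁ k)             ≡⟨ cong (_- heights (inject₁ k)) (psum-snoc p k) ⟩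
        (heights (inject₁ k) + p k) - heights (inject₁ k) ≡⟨ cong (_- heights (inject₁ k)) (+-comm _ (p k)) ⟩
        (p k + heights (inject₁ k)) - heights (inject₁ k) ≡⟨ add-sub (p k) _ ⟩
        p k                                               ∎

-- Both inclusions follow from the slice description.
theorem3p3 : (R : RealField) → (r m : ℕ) → (U L : Fin (r +ℕ m) → Bool) →
    IsLatticePath r m U → IsLatticePath r m L → NeverAbove L U →
    (p : Fin (r +ℕ m) → RealField.ℝ R) →
    (InCM R U L p → InPolytope R U L p) × (InPolytope R U L p → InCM R U L p)
theorem3p3 R r m U L U-path L-path _ p =
  necessity p , sufficiency (same-endpoint U-path L-path) p
  where
  open GeneralizedLatticePaths R
  open Slices U L
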